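{- Let $P$ be a finite poset. (i) If $P$ is a $\{C,D\}$-order with no induced subposet isomorphic to $\mathbf{2}+\mathbf{2}$, then $P$ is an $\{A,B\}$-order and an $\{A,C\}$-order. (ii) If $P$ is an $\{A,C\}$-order with no induced subposet isomorphic to $Z$, then $P$ is an $\{A,B\}$-order and a $\{C,D\}$-order. (iii) If $P$ is an $\{A,B\}$-order with no induced subposet isomorphic to $H$, then $P$ is a $\{C,D\}$-order and an $\{A,C\}$-order.
   Context: Interval types: every interval $I_v$ has left endpoint $L(v)$, right endpoint $R(v)$, center $c(v)=(L(v)+R(v))/2$, and one of four types: $A$ (endpoints closed, center closed), $B$ (endpoints open, center open), $C$ (endpoints closed, center open), $D$ (endpoints open, center closed); the center always belongs to the interval. For nonempty $S\subseteq\{A,B,C,D\}$, an $S$-representation of a poset $(X,\prec)$ assigns to each $x\in X$ an interval $I_x$, all of the same positive length, each of type in $S$, such that $x\prec y$ iff (i) $R(x)<c(y)$, or (ii) $R(x)=c(y)$, at least one of $R(x),c(y)$ is open, and at least one of $L(y),c(x)$ is open. An $S$-order is a poset with an $S$-representation. $\mathbf{2}+\mathbf{2}$ is the disjoint union of two 2-element chains. $H$ has elements $a\prec b\prec c\prec d$, $e$, $f$ with the only further relations $b\prec f$ (hence $a\prec f$) and $e\prec c$ (hence $e\prec d$). $Z$ has elements $a\prec b\prec c\prec d$, $e$, $f$ with the only further relations $e\prec d$ and $a\prec f$.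
   Formalization: The endpoints and the common length of the intervals in every S-representation, in the hypotheses and the conclusions alike, are rational numbers. -}

module Defs where

open import Data.Nat using (ℕ)
open import Data.Fin using (Fin; toℕ)
open import Data.Bool using (Bool; true; false; T)
open import Data.Rational using (ℚ; 0ℚ; ½; _+_; _*_; _<_)
open import Data.Product using (Σ; _×_; _,_)
open import Data.Sum using (_⊎_)
open import Data.List using (List; _∷_; [])
open import Data.List.Membership.Propositional using (_∈_)
open import Relation.Binary.PropositionalEquality using (_≡_)
open import Relation.Nullary using (¬_)
open import Function.Definitions using (Injective)

data IType : Set where
  A B C D : IType

endOpen : IType → Bool
endOpen A = false
endOpen B = true
endOpen C = false
endOpen D = true

cenOpen : IType → Bool
cenOpen A = false
cenOpen B = true
cenOpen C = true
cenOpen D = false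

record FinPoset : Set₁ where
  field
    n       : ℕ
    _≺_     : Fin n → Fin n → Set
    irrefl  : ∀ x → ¬ (x ≺ x)
    trans   : ∀ {x y z} → x ≺ y → y ≺ z → x ≺ z

record Representation (S : List IType) (P : FinPoset) : Set where
  open FinPoset P
  field
    L     : Fin n → ℚ
    len   : ℚ
    len>0 : 0ℚ < len
    ty    : Fin n → IType
    ty∈S  : ∀ x → ty x ∈ S
  R : Fin n → ℚ
  R x = L x + len
  c : Fin n → ℚ
  c x = L x + ½ * len
  field
    correct : ∀ x y →
      (x ≺ y →
         (R x < c y) ⊎
         (R x ≡ c y × (T (endOpen (ty x)) ⊎ T (cenOpen (ty y)))
                    × (T (endOpen (ty y)) ⊎ T (cenOpen (ty x)))))
      × ((R x < c y) ⊎
         (R x ≡ c y × (T (endOpen (ty x)) ⊎ T (cenOpen (ty y)))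
                    × (T (endOpen (ty y)) ⊎ T (cenOpen (ty x))))
         → x ≺ y)

IsSOrder : List IType → FinPoset → Set
IsSOrder S P = Representation S P

AB AC CD : List IType
AB = A ∷ B ∷ []
AC = A ∷ C ∷ []
CD = C ∷ D ∷ []

record Pattern : Set₁ where
  field
    k   : ℕ
    rel : Fin k → Fin k → Set

ContainsInduced : Pattern → FinPoset → Set
ContainsInduced Q P =
  Σ (Fin (Pattern.k Q) → Fin (FinPoset.n P)) λ f →
    Injective _≡_ _≡_ f ×
    (∀ i j → (Pattern.rel Q i j → FinPoset._≺_ P (f i) (f j))
           × (FinPoset._≺_ P (f i) (f j) → Pattern.rel Q i j))

rel2+2 : ℕ → ℕ → Bool
rel2+2 0 1 = true
rel2+2 2 3 = true
rel2+2 _ _ = false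

-- H on a=0,b=1,c=2,d=3,e=4,f=5: chain a≺b≺c≺d, b≺f, a≺f, e≺c, e≺d.
relH : ℕ → ℕ → Bool
relH 0 1 = true
relH 0 2 = true
relH 0 3 = true
relH 1 2 = true
relH 1 3 = true
relH 2 3 = true
relH 1 5 = true
relH 0 5 = true
relH 4 2 = true
relH 4 3 = true
relH _ _ = false

-- Z on a=0,...,f=5: chain a≺b≺c≺d, e≺d, a≺f.
relZ : ℕ → ℕ → Bool
relZ 0 1 = true
relZ 0 2 = true
relZ 0 3 = true
relZ 1 2 = true
relZ 1 3 = true
relZ 2 3 = true
relZ 4 3 = true
relZ 0 5 = true
relZ _ _ = false

TwoPlusTwo H Z : Pattern
TwoPlusTwo = record { k = 4 ; rel = λ i j → T (rel2+2 (toℕ i) (toℕ j)) }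
H          = record { k = 6 ; rel = λ i j → T (relH (toℕ i) (toℕ j)) }
Z          = record { k = 6 ; rel = λ i j → T (relZ (toℕ i) (toℕ j)) }

-- Rescale so that every interval has length 2. Then x ≺ y is decided by L y - L x alone, except
-- when L y = L x + 1, where it is decided by the tie condition of the two types. So it suffices to
-- choose new types and integer shifts g and to move every interval by ε g, with ε so small that no
-- strict comparison changes: a unit pair is then compared by g and, where g agrees, by the tie
-- condition of the new types.
--
-- The shift is g = 3 height + offset. Along a chain of levels q, q + 1, q + 2, … the height grows by
-- +1, -1 or 0 according as all, none or only some of the pairs of types occurring on two consecutive
-- levels tie; the offset and the new type of an element depend only on the parity of its level and
-- on which types occur on its own and the two neighbouring levels. For each of the four retypings an
-- exhaustive check of these local configurations shows that unit pairs keep their comparability,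
-- except in configurations that contain an induced 2+2, Z or H. Finally {A,B}- and {A,C}-orders have
-- no induced 2+2, their tie relations being Ferrers relations; this supplies the 2+2-freeness needed
-- to go on from the {C,D}-representations obtained in (ii) and (iii).

module Submission where

open import Defs
open import Algebra.Bundles using (CommutativeMonoid; CommutativeRing)
open import Data.Bool using (Bool; true; false; T; not; _xor_; _∧_; _∨_; if_then_else_)
import Data.Bool.Properties as BoolP
open import Data.Empty using (⊥-elim)
open import Data.Fin using (Fin; zero; suc; toℕ; inject₁)
open import Data.Fin.Patterns using (0F; 1F; 2F; 3F)
import Data.Fin.Properties as FP
open import Data.Integer as ℤ using (ℤ; +_)
import Data.Integer.Properties as ℤP
open import Data.List using (List; _∷_; [])
open import Data.List.Membership.Propositional using (_∈_)
open import Data.List.Membership.Propositional.Properties using (∈-cartesianProduct⁺)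
open import Data.List.Relation.Unary.All as All using (All)
open import Data.List.Relation.Unary.Any as Any using (Any; here; there)
open import Data.Maybe using (Maybe; just; nothing)
import Data.Maybe.Properties as MaybeP
open import Data.Nat as ℕ using (ℕ)
import Data.Nat.Properties as ℕP
open import Data.Product using (∃-syntax; _×_; _,_; proj₁; proj₂)
import Data.Product.Properties as ×P
open import Data.Rational as ℚ
  using (ℚ; 0ℚ; 1ℚ; ½; 1/_; _+_; _*_; _-_; -_; _<_; _≤_; ∣_∣; _÷_; _⊓_; Positive; NonNegative; NonZero; *<*)
open import Data.Rational.Literals using (fromℤ)
import Data.Rational.Properties as ℚP
open import Data.Rational.Solver using (module +-*-Solver)
open import Data.Sum using (_⊎_; inj₁; inj₂; [_,_]′)
open import Data.Vec using (Vec; _∷_; []; lookup)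
import Data.Vec.Properties as VecP
open import Function using (_∘_; _⇔_; mk⇔; Equivalence)
open import Function.Properties.Equivalence using () renaming (trans to ⇔-trans; sym to ⇔-sym)
open import Level using (0ℓ)
open import Relation.Binary
  using (DecidableEquality; Rel; Tri; Trichotomous; Irreflexive; Asymmetric; tri<; tri≈; tri>; _Preserves_⟶_)
open import Relation.Binary.PropositionalEquality
  using (_≡_; _≢_; refl; sym; trans; cong; cong₂; subst; subst₂; module ≡-Reasoning)
open import Relation.Nullary using (¬_; Dec; yes; no; isYes)
open import Relation.Nullary.Decidable
  using (_×-dec_; _⊎-dec_; _→-dec_; ¬?; map′; T?; toWitness; fromWitness; from-yes)

open Equivalence using (to; from)

-- Rational arithmetic

fromℤ-+ : ∀ a b → fromℤ (a ℤ.+ b) ≡ fromℤ a + fromℤ b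
fromℤ-+ a b = sym (trans (cong (ℚ._/ 1) (cong₂ ℤ._+_ (ℤP.*-identityʳ a) (ℤP.*-identityʳ b)))
                         (ℚP.↥p/↧p≡p (fromℤ (a ℤ.+ b))))

fromℤ-mono-< : fromℤ Preserves ℤ._<_ ⟶ _<_
fromℤ-mono-< {a} {b} a<b = *<* (subst₂ ℤ._<_ (sym (ℤP.*-identityʳ a)) (sym (ℤP.*-identityʳ b)) a<b)

+-cancelʳ : ∀ {p q} r → p + r ≡ q + r → p ≡ q
+-cancelʳ {p} {q} r = ∙-cancelʳ r p q
  where open import Algebra.Properties.Group ℚP.+-0-group using (∙-cancelʳ)

+-cancelˡ : ∀ r {p q} → r + p ≡ r + q → p ≡ q
+-cancelˡ r {p} {q} = ∙-cancelˡ r p q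
  where open import Algebra.Properties.Group ℚP.+-0-group using (∙-cancelˡ)

fromℤ-suc : ∀ k → fromℤ (+ ℕ.suc k) ≡ fromℤ (+ k) + 1ℚ
fromℤ-suc k = trans (cong (λ m → fromℤ (+ m)) (ℕP.+-comm 1 k)) (fromℤ-+ (+ k) (+ 1))

p-q≡0⇒p≡q : ∀ {p q} → p - q ≡ 0ℚ → p ≡ q
p-q≡0⇒p≡q {p} {q} p-q≡0 = begin
  p             ≡⟨ solve 2 (λ p q → p := (p :- q) :+ q) refl p q ⟩
  (p - q) + q   ≡⟨ cong (_+ q) p-q≡0 ⟩
  0ℚ + q        ≡⟨ ℚP.+-identityˡ q ⟩
  q             ∎
  where open ≡-Reasoning
        open +-*-Solver using (solve; _:+_; _:-_; _:=_)

p≤∣p∣ : ∀ p → p ≤ ∣ p ∣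
p≤∣p∣ p with ℚP.∣p∣≡p∨∣p∣≡-p p
... | inj₁ ∣p∣≡p  = ℚP.≤-reflexive (sym ∣p∣≡p)
... | inj₂ ∣p∣≡-p = ℚP.≤-trans p≤0 (ℚP.0≤∣p∣ p)
  where
  open +-*-Solver using (solve; _:-_; :-_; _:=_)
  p≤0 : p ≤ 0ℚ
  p≤0 = subst₂ _≤_ (solve 1 (λ p → :- (:- p) := p) refl p) refl
                   (ℚP.neg-antimono-≤ (subst (0ℚ ≤_) ∣p∣≡-p (ℚP.0≤∣p∣ p)))

p≢0⇒0<∣p∣ : ∀ {p} → p ≢ 0ℚ → 0ℚ < ∣ p ∣
p≢0⇒0<∣p∣ {p} p≢0 with ℚP.<-cmp 0ℚ ∣ p ∣
... | tri< 0<∣p∣ _ _ = 0<∣p∣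
... | tri≈ _ 0≡∣p∣ _ = ⊥-elim (p≢0 (ℚP.∣p∣≡0⇒p≡0 p (sym 0≡∣p∣)))
... | tri> _ _ ∣p∣<0 = ⊥-elim (ℚP.<-irrefl refl (ℚP.<-≤-trans ∣p∣<0 (ℚP.0≤∣p∣ p)))

∣p-q∣≡∣q-p∣ : ∀ p q → ∣ p - q ∣ ≡ ∣ q - p ∣
∣p-q∣≡∣q-p∣ p q = trans (cong ∣_∣ (solve 2 (λ p q → p :- q := :- (q :- p)) refl p q)) (ℚP.∣-p∣≡∣p∣ (q - p))
  where open +-*-Solver using (solve; _:-_; :-_; _:=_)

p≤q⇒∣p-q∣≡q-p : ∀ {p q} → p ≤ q → ∣ p - q ∣ ≡ q - p
p≤q⇒∣p-q∣≡q-p {p} {q} p≤q =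
  trans (∣p-q∣≡∣q-p∣ p q) (ℚP.0≤p⇒∣p∣≡p (subst (_≤ q - p) (ℚP.+-inverseʳ p) (ℚP.+-monoˡ-≤ (- p) p≤q)))

perturb-< : ∀ {a b u v ε} .{{_ : NonNegative ε}} → a < b → ε * ∣ u - v ∣ < ∣ a - b ∣ → a + ε * u < b + ε * v
perturb-< {a} {b} {u} {v} {ε} a<b small = begin-strict
  a + ε * u                    ≡⟨ solve 4 (λ a u v ε → a :+ ε :* u := (a :+ ε :* (u :- v)) :+ ε :* v) refl a u v ε ⟩
  (a + ε * (u - v)) + ε * v    ≤⟨ ℚP.+-monoˡ-≤ (ε * v) (ℚP.+-monoʳ-≤ a (ℚP.*-monoˡ-≤-nonNeg ε (p≤∣p∣ (u - v)))) ⟩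
  (a + ε * ∣ u - v ∣) + ε * v  <⟨ ℚP.+-monoˡ-< (ε * v) (ℚP.+-monoʳ-< a small) ⟩
  (a + ∣ a - b ∣) + ε * v      ≡⟨ cong (λ d → (a + d) + ε * v) (p≤q⇒∣p-q∣≡q-p (ℚP.<⇒≤ a<b)) ⟩
  (a + (b - a)) + ε * v        ≡⟨ solve 3 (λ a b w → (a :+ (b :- a)) :+ w := b :+ w) refl a b (ε * v) ⟩
  b + ε * v                    ∎
  where open ℚP.≤-Reasoning
        open +-*-Solver using (solve; _:+_; _:*_; _:-_; _:=_)

positive-lower-bound : ∀ {k} (b : Fin k → ℚ) → (∀ i → 0ℚ < b i) → ∃[ ε ] 0ℚ < ε × (∀ i → ε ≤ b i)
positive-lower-bound {ℕ.zero} b _ = 1ℚ , ℚP.positive⁻¹ 1ℚ , λ ()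
positive-lower-bound {ℕ.suc k} b b>0 with positive-lower-bound (b ∘ suc) (b>0 ∘ suc)
... | ε , ε>0 , ε≤b = b zero ⊓ ε , [ positive-if (b>0 zero) , positive-if ε>0 ]′ (ℚP.⊓-sel (b zero) ε) , below
  where
  positive-if : ∀ {q} → 0ℚ < q → b zero ⊓ ε ≡ q → 0ℚ < b zero ⊓ ε
  positive-if q>0 eq = subst (0ℚ <_) (sym eq) q>0
  below : ∀ i → b zero ⊓ ε ≤ b i
  below zero    = ℚP.p⊓q≤p (b zero) ε
  below (suc i) = ℚP.≤-trans (ℚP.p⊓q≤q (b zero) ε) (ε≤b i)

small-multiplier : ∀ {k} (u d : Fin k → Fin k → ℚ) →
                   ∃[ ε ] 0ℚ < ε × (∀ i j → d i j ≢ 0ℚ → ε * ∣ u i j ∣ < ∣ d i j ∣)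
small-multiplier {k} u d = proj₁ lower , proj₁ (proj₂ lower) , small
  where
  instance
    ∣u∣-nonNeg : ∀ {i j} → NonNegative ∣ u i j ∣
    ∣u∣-nonNeg {i} {j} = ℚP.∣-∣-nonNeg (u i j)
    1+∣u∣-positive : ∀ {i j} → Positive (1ℚ + ∣ u i j ∣)
    1+∣u∣-positive {i} {j} = ℚP.pos+nonNeg⇒pos 1ℚ ∣ u i j ∣
    1+∣u∣-nonZero : ∀ {i j} → NonZero (1ℚ + ∣ u i j ∣)
    1+∣u∣-nonZero {i} {j} = ℚP.pos⇒nonZero (1ℚ + ∣ u i j ∣)

  quotient-positive : ∀ {i j} → d i j ≢ 0ℚ → Positive (∣ d i j ∣ ÷ (1ℚ + ∣ u i j ∣))
  quotient-positive {i} {j} d≢0 =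
    ℚP.pos*pos⇒pos ∣ d i j ∣ {{ℚ.positive (p≢0⇒0<∣p∣ d≢0)}} (1/ (1ℚ + ∣ u i j ∣)) {{ℚP.1/pos⇒pos (1ℚ + ∣ u i j ∣)}}

  quotient-small : ∀ {i j} → d i j ≢ 0ℚ → ∣ d i j ∣ ÷ (1ℚ + ∣ u i j ∣) * ∣ u i j ∣ < ∣ d i j ∣
  quotient-small {i} {j} d≢0 = begin-strict
    a * w * c          <⟨ ℚP.*-monoʳ-<-pos (a * w) {{quotient-positive d≢0}} c<1+c ⟩
    a * w * (1ℚ + c)   ≡⟨ ℚP.*-assoc a w (1ℚ + c) ⟩
    a * (w * (1ℚ + c)) ≡⟨ cong (a *_) (ℚP.*-inverseˡ (1ℚ + c)) ⟩
    a * 1ℚ             ≡⟨ ℚP.*-identityʳ a ⟩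
    a                  ∎
    where
    open ℚP.≤-Reasoning
    a c w : ℚ
    a = ∣ d i j ∣
    c = ∣ u i j ∣
    w = 1/ (1ℚ + c)
    c<1+c : c < 1ℚ + c
    c<1+c = subst (_< 1ℚ + c) (ℚP.+-identityˡ c) (ℚP.+-monoˡ-< c (ℚP.positive⁻¹ 1ℚ))

  bound : Fin k → Fin k → ℚ
  bound i j with d i j ℚ.≟ 0ℚ
  ... | yes _ = 1ℚ
  ... | no _  = ∣ d i j ∣ ÷ (1ℚ + ∣ u i j ∣)

  bound>0 : ∀ i j → 0ℚ < bound i j
  bound>0 i j with d i j ℚ.≟ 0ℚ
  ... | yes _  = ℚP.positive⁻¹ 1ℚ
  ... | no d≢0 = ℚP.positive⁻¹ _ {{quotient-positive d≢0}}

  bound-small : ∀ i j → d i j ≢ 0ℚ → bound i j * ∣ u i j ∣ < ∣ d i j ∣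
  bound-small i j d≢0 with d i j ℚ.≟ 0ℚ
  ... | yes d≡0 = ⊥-elim (d≢0 d≡0)
  ... | no _    = quotient-small d≢0

  row : ∀ i → ∃[ ε ] 0ℚ < ε × (∀ j → ε ≤ bound i j)
  row i = positive-lower-bound (bound i) (bound>0 i)

  lower : ∃[ ε ] 0ℚ < ε × (∀ i → ε ≤ proj₁ (row i))
  lower = positive-lower-bound (proj₁ ∘ row) (proj₁ ∘ proj₂ ∘ row)

  small : ∀ i j → d i j ≢ 0ℚ → proj₁ lower * ∣ u i j ∣ < ∣ d i j ∣
  small i j d≢0 =
    ℚP.≤-<-trans (ℚP.*-monoʳ-≤-nonNeg ∣ u i j ∣ (ℚP.≤-trans (proj₂ (proj₂ lower) i) (proj₂ (proj₂ (row i)) j)))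
                 (bound-small i j d≢0)

IsPositiveInteger : ℚ → Set
IsPositiveInteger q = ∃[ k ] q ≡ fromℤ (+ ℕ.suc k)

isPositiveInteger? : ∀ q → Dec (IsPositiveInteger q)
isPositiveInteger? q with q ℚ.≟ fromℤ (ℚ.numerator q)
... | no q≢ = no λ (k , q≡k) → q≢ (trans q≡k (cong fromℤ (sym (cong ℚ.numerator q≡k))))
... | yes q≡ = decide (ℚ.numerator q) q≡
  where
  not-positive : ∀ {m} → (∀ {k} → m ≢ + ℕ.suc k) → q ≡ fromℤ m → ¬ IsPositiveInteger q
  not-positive m≢ q≡m (k , q≡k) = m≢ (trans (sym (cong ℚ.numerator q≡m)) (cong ℚ.numerator q≡k))
  decide : ∀ m → q ≡ fromℤ m → Dec (IsPositiveInteger q)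
  decide (+ ℕ.suc k) q≡m = yes (k , q≡m)
  decide (+ ℕ.zero)  q≡m = no (not-positive (λ ()) q≡m)
  decide ℤ.-[1+ _ ]  q≡m = no (not-positive (λ ()) q≡m)

¬IsPositiveInteger-0 : ¬ IsPositiveInteger 0ℚ
¬IsPositiveInteger-0 (k , 0≡k) = ℕP.0≢1+n (ℤP.+-injective (cong ℚ.numerator 0≡k))

IsPositiveInteger-suc : ∀ r → IsPositiveInteger (r + 1ℚ) ⇔ (r ≡ 0ℚ ⊎ IsPositiveInteger r)
IsPositiveInteger-suc r = mk⇔ forward backward
  where
  forward : IsPositiveInteger (r + 1ℚ) → r ≡ 0ℚ ⊎ IsPositiveInteger r
  forward (ℕ.zero  , r+1≡1)   = inj₁ (+-cancelʳ 1ℚ r+1≡1)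
  forward (ℕ.suc k , r+1≡k+2) = inj₂ (k , +-cancelʳ 1ℚ (trans r+1≡k+2 (fromℤ-suc (ℕ.suc k))))
  backward : r ≡ 0ℚ ⊎ IsPositiveInteger r → IsPositiveInteger (r + 1ℚ)
  backward (inj₁ refl)       = 0 , refl
  backward (inj₂ (k , refl)) = ℕ.suc k , sym (fromℤ-suc (ℕ.suc k))

-- Ties and precedence

Tie : IType → IType → Set
Tie s t = (T (endOpen s) ⊎ T (cenOpen t)) × (T (endOpen t) ⊎ T (cenOpen s))

Precedes : {A : Set} → Rel A 0ℓ → A → A → IType → IType → Set
Precedes _<_ r c s t = r < c ⊎ (r ≡ c × Tie s t)

module _ {A B : Set} {_<₁_ : Rel A 0ℓ} {_<₂_ : Rel B 0ℓ}
         (compare : Trichotomous _≡_ _<₁_) (irrefl : Irreflexive _≡_ _<₂_) (asym : Asymmetric _<₂_)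
         (f : A → B) (mono : f Preserves _<₁_ ⟶ _<₂_) where

  Precedes-map : ∀ {a b s t} → Precedes _<₁_ a b s t ⇔ Precedes _<₂_ (f a) (f b) s t
  Precedes-map {a} {b} = mk⇔ forward (backward (compare a b))
    where
    forward : ∀ {s t} → Precedes _<₁_ a b s t → Precedes _<₂_ (f a) (f b) s t
    forward (inj₁ a<b)          = inj₁ (mono a<b)
    forward (inj₂ (refl , tie)) = inj₂ (refl , tie)
    backward : ∀ {s t} → Tri (a <₁ b) (a ≡ b) (b <₁ a) → Precedes _<₂_ (f a) (f b) s t → Precedes _<₁_ a b s t
    backward (tri< a<b _ _)  _                    = inj₁ a<b
    backward (tri≈ _ refl _) (inj₁ fa<fa)         = ⊥-elim (irrefl refl fa<fa)
    backward (tri≈ _ refl _) (inj₂ (_ , tie))     = inj₂ (refl , tie)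
    backward (tri> _ _ b<a)  (inj₁ fa<fb)         = ⊥-elim (asym fa<fb (mono b<a))
    backward (tri> _ _ b<a)  (inj₂ (fa≡fb , _))   = ⊥-elim (irrefl (sym fa≡fb) (mono b<a))

Precedes-refl : {A : Set} {_<_ : Rel A 0ℓ} → Irreflexive _≡_ _<_ → ∀ {a s t} → Precedes _<_ a a s t ⇔ Tie s t
Precedes-refl irrefl =
  mk⇔ (λ { (inj₁ a<a) → ⊥-elim (irrefl refl a<a) ; (inj₂ (_ , tie)) → tie }) (λ tie → inj₂ (refl , tie))

Precedes-cong : {A : Set} {_<_ : Rel A 0ℓ} {r r′ c c′ : A} {s s′ t t′ : IType} →
                r ≡ r′ → c ≡ c′ → s ≡ s′ → t ≡ t′ → Precedes _<_ r c s t ⇔ Precedes _<_ r′ c′ s′ t′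
Precedes-cong refl refl refl refl = mk⇔ (λ p → p) (λ p → p)

>⇒¬Precedes : {A : Set} {_<_ : Rel A 0ℓ} → Irreflexive _≡_ _<_ → Asymmetric _<_ →
              ∀ {a b s t} → b < a → ¬ Precedes _<_ a b s t
>⇒¬Precedes irrefl asym b<a (inj₁ a<b)       = asym a<b b<a
>⇒¬Precedes irrefl asym b<a (inj₂ (a≡b , _)) = irrefl (sym a≡b) b<a

Precedes⇒≤ : ∀ {a b s t} → Precedes _<_ a b s t → a ≤ b
Precedes⇒≤ (inj₁ a<b)       = ℚP.<⇒≤ a<b
Precedes⇒≤ (inj₂ (a≡b , _)) = ℚP.≤-reflexive a≡b

¬Precedes⇒≥ : ∀ {a b s t} → ¬ Precedes _<_ a b s t → b ≤ a
¬Precedes⇒≥ ¬p = ℚP.≮⇒≥ (¬p ∘ inj₁)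

-- Unit representations

-- Representations by intervals of length 2, in which R x - 1 = L x + 1 and c y - 1 = L y.
record UnitRep (S : List IType) (P : FinPoset) : Set where
  open FinPoset P
  field
    L       : Fin n → ℚ
    ty      : Fin n → IType
    ty∈S    : ∀ x → ty x ∈ S
    correct : ∀ x y → x ≺ y ⇔ Precedes _<_ (L x + 1ℚ) (L y) (ty x) (ty y)

module _ {S : List IType} {P : FinPoset} where
  open FinPoset P using (n; _≺_)

  representation : UnitRep S P → Representation S P
  representation N = record
    { L = L ; len = 1ℚ + 1ℚ ; len>0 = ℚP.positive⁻¹ (1ℚ + 1ℚ) ; ty = ty ; ty∈S = ty∈S
    ; correct = λ x y → to (correct′ x y) , from (correct′ x y) }
    where
    open UnitRep N
    correct′ : ∀ x y → x ≺ y ⇔ Precedes _<_ (L x + (1ℚ + 1ℚ)) (L y + ½ * (1ℚ + 1ℚ)) (ty x) (ty y)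
    correct′ x y =
      ⇔-trans (correct x y)
      (⇔-trans (Precedes-map ℚP.<-cmp ℚP.<-irrefl ℚP.<-asym (_+ 1ℚ) (ℚP.+-monoˡ-< 1ℚ))
               (Precedes-cong {_<_ = _<_} (ℚP.+-assoc (L x) 1ℚ 1ℚ) refl refl refl))

  unitRep : Representation S P → UnitRep S P
  unitRep rep = record { L = λ x → L x * κ ; ty = ty ; ty∈S = ty∈S ; correct = correct′ }
    where
    open Representation rep
    open +-*-Solver using (solve; _:+_; _:*_; _:-_; _:=_; con)
    h : ℚ
    h = ½ * len
    instance
      h-positive : Positive h
      h-positive = ℚP.pos*pos⇒pos ½ len {{ℚ.positive len>0}}
      h-nonZero : NonZero h
      h-nonZero = ℚP.pos⇒nonZero h
    κ : ℚ
    κ = 1/ h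
    instance
      κ-positive : Positive κ
      κ-positive = ℚP.1/pos⇒pos h
    rescale : ℚ → ℚ
    rescale q = (q - h) * κ
    rescale-mono : rescale Preserves _<_ ⟶ _<_
    rescale-mono q<q′ = ℚP.*-monoˡ-<-pos κ (ℚP.+-monoˡ-< (- h) q<q′)
    rescale-R : ∀ x → rescale (R x) ≡ L x * κ + 1ℚ
    rescale-R x =
      trans (solve 3 (λ a l k → ((a :+ l) :- con ½ :* l) :* k := a :* k :+ (con ½ :* l) :* k) refl (L x) len κ)
            (cong (λ q → L x * κ + q) (ℚP.*-inverseʳ h))
    rescale-c : ∀ y → rescale (c y) ≡ L y * κ
    rescale-c y = solve 3 (λ a l k → ((a :+ con ½ :* l) :- con ½ :* l) :* k := a :* k) refl (L y) len κ
    correct′ : ∀ x y → x ≺ y ⇔ Precedes _<_ (L x * κ + 1ℚ) (L y * κ) (ty x) (ty y)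
    correct′ x y =
      ⇔-trans (mk⇔ (proj₁ (correct x y)) (proj₂ (correct x y)))
      (⇔-trans (Precedes-map ℚP.<-cmp ℚP.<-irrefl ℚP.<-asym rescale rescale-mono)
               (Precedes-cong {_<_ = _<_} (rescale-R x) (rescale-c y) refl refl))

  perturb : (N : UnitRep S P) {S′ : List IType} (ty′ : Fin n → IType) → (∀ x → ty′ x ∈ S′) → (g : Fin n → ℤ) →
            (∀ x y → UnitRep.L N y ≡ UnitRep.L N x + 1ℚ → x ≺ y ⇔ Precedes ℤ._<_ (g x) (g y) (ty′ x) (ty′ y)) →
            UnitRep S′ P
  perturb N ty′ ty′∈S′ g unit-pairs = record { L = L′ ; ty = ty′ ; ty∈S = ty′∈S′ ; correct = correct′ }
    where
    open UnitRep N
    open +-*-Solver using (solve; _:+_; _:*_; _:=_; con)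

    γ : Fin n → ℚ
    γ x = fromℤ (g x)

    smallness : ∃[ ε ] 0ℚ < ε × (∀ x y → (L x + 1ℚ) - L y ≢ 0ℚ → ε * ∣ γ x - γ y ∣ < ∣ (L x + 1ℚ) - L y ∣)
    smallness = small-multiplier (λ x y → γ x - γ y) (λ x y → (L x + 1ℚ) - L y)
    ε : ℚ
    ε = proj₁ smallness
    instance
      ε-positive : Positive ε
      ε-positive = ℚ.positive (proj₁ (proj₂ smallness))
    ε-small : ∀ x y → (L x + 1ℚ) - L y ≢ 0ℚ → ε * ∣ γ x - γ y ∣ < ∣ (L x + 1ℚ) - L y ∣
    ε-small = proj₂ (proj₂ smallness)

    L′ : Fin n → ℚ
    L′ x = L x + ε * γ x

    L′-shift : ∀ x → L′ x + 1ℚ ≡ (L x + 1ℚ) + ε * γ x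
    L′-shift x = solve 2 (λ a w → (a :+ w) :+ con 1ℚ := (a :+ con 1ℚ) :+ w) refl (L x) (ε * γ x)

    gap≢0 : ∀ {x y} → L x + 1ℚ ≢ L y → (L x + 1ℚ) - L y ≢ 0ℚ
    gap≢0 x+1≢y = x+1≢y ∘ p-q≡0⇒p≡q

    correct′ : ∀ x y → x ≺ y ⇔ Precedes _<_ (L′ x + 1ℚ) (L′ y) (ty′ x) (ty′ y)
    correct′ x y with ℚP.<-cmp (L x + 1ℚ) (L y)
    ... | tri< lt x+1≢y _ = mk⇔ (λ _ → inj₁ shifted) (λ _ → from (correct x y) (inj₁ lt))
      where
      shifted : L′ x + 1ℚ < L′ y
      shifted = subst (_< L′ y) (sym (L′-shift x))
                  (perturb-< {u = γ x} {γ y} {ε} {{ℚP.pos⇒nonNeg ε}} lt (ε-small x y (gap≢0 x+1≢y)))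
    ... | tri> _ x+1≢y gt = mk⇔ (λ x≺y → ⊥-elim (>⇒¬Precedes ℚP.<-irrefl ℚP.<-asym gt (to (correct x y) x≺y)))
                            (λ p → ⊥-elim (>⇒¬Precedes ℚP.<-irrefl ℚP.<-asym shifted p))
      where
      shifted : L′ y < L′ x + 1ℚ
      shifted = subst (L′ y <_) (sym (L′-shift x))
                  (perturb-< {u = γ y} {γ x} {ε} {{ℚP.pos⇒nonNeg ε}} gt
                    (subst₂ (λ a b → ε * a < b) (∣p-q∣≡∣q-p∣ (γ x) (γ y)) (∣p-q∣≡∣q-p∣ (L x + 1ℚ) (L y))
                      (ε-small x y (gap≢0 x+1≢y))))
    ... | tri≈ _ eq _ =
      ⇔-trans (unit-pairs x y (sym eq))
        (⇔-trans (Precedes-map ℤP.<-cmp ℚP.<-irrefl ℚP.<-asym shift shift-mono)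
                 (Precedes-cong {_<_ = _<_} (sym (L′-shift x)) (cong (λ c → c + ε * γ y) eq) refl refl))
      where
      shift : ℤ → ℚ
      shift k = (L x + 1ℚ) + ε * fromℤ k
      shift-mono : shift Preserves ℤ._<_ ⟶ _<_
      shift-mono k<k′ = ℚP.+-monoʳ-< (L x + 1ℚ) (ℚP.*-monoʳ-<-pos ε (fromℤ-mono-< k<k′))

-- Potentials along unit-spaced levels

module IndicatorSums {c ℓ} (M : CommutativeMonoid c ℓ) where
  open CommutativeMonoid M using (Carrier; _≈_; _∙_; ε; identityˡ; identityʳ; ∙-cong; ∙-congˡ; ∙-congʳ; setoid)
  private
    module ≈ = CommutativeMonoid M using (refl; sym; trans)
  open import Algebra.Properties.CommutativeMonoid.Sum M using (sum)
  open import Relation.Binary.Reasoning.Setoid setoid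

  when : {A : Set} → Dec A → Carrier → Carrier
  when (yes _) v = v
  when (no _)  v = ε

  when-⊎ : {A′ A B : Set} → A′ ⇔ (A ⊎ B) → ¬ (A × B) →
           (a′ : Dec A′) (a : Dec A) (b : Dec B) (v : Carrier) → when a′ v ≈ when a v ∙ when b v
  when-⊎ _  disjoint (yes _)  (yes a) (yes b) v = ⊥-elim (disjoint (a , b))
  when-⊎ _  _        (yes _)  (yes _) (no _)  v = ≈.sym (identityʳ v)
  when-⊎ _  _        (yes _)  (no _)  (yes _) v = ≈.sym (identityˡ v)
  when-⊎ eq _        (yes a′) (no ¬a) (no ¬b) v = ⊥-elim ([ ¬a , ¬b ]′ (to eq a′))
  when-⊎ eq _        (no ¬a′) (yes a) _       v = ⊥-elim (¬a′ (from eq (inj₁ a)))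
  when-⊎ eq _        (no ¬a′) (no _)  (yes b) v = ⊥-elim (¬a′ (from eq (inj₂ b)))
  when-⊎ _  _        (no _)   (no _)  (no _)  v = ≈.sym (identityˡ ε)

  sum-single : ∀ {k} (f : Fin k → Carrier) i → (∀ j → j ≢ i → f j ≈ ε) → sum f ≈ f i
  sum-single {ℕ.suc k} f zero others = begin
    f zero ∙ sum (f ∘ suc) ≈⟨ ∙-congˡ (sum-ε (f ∘ suc) (λ j → others (suc j) (λ ()))) ⟩
    f zero ∙ ε             ≈⟨ identityʳ (f zero) ⟩
    f zero                 ∎
    where
    sum-ε : ∀ {m} (h : Fin m → Carrier) → (∀ j → h j ≈ ε) → sum h ≈ ε
    sum-ε {ℕ.zero}  h _   = ≈.refl
    sum-ε {ℕ.suc m} h h≈ε = ≈.trans (∙-cong (h≈ε zero) (sum-ε (h ∘ suc) (h≈ε ∘ suc))) (identityˡ ε)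
  sum-single {ℕ.suc k} f (suc i) others = begin
    f zero ∙ sum (f ∘ suc) ≈⟨ ∙-congʳ (others zero (λ ())) ⟩
    ε ∙ sum (f ∘ suc)      ≈⟨ identityˡ _ ⟩
    sum (f ∘ suc)          ≈⟨ sum-single (f ∘ suc) i (λ j j≢i → others (suc j) (j≢i ∘ FP.suc-injective)) ⟩
    f (suc i)              ∎

-- potential σ q sums σ over the distinct positions lying a positive integer below q.
module Potential {n : ℕ} (pos : Fin n → ℚ) {c ℓ} (M : CommutativeMonoid c ℓ) where
  open CommutativeMonoid M using (Carrier; _≈_; _∙_; ε; ∙-congˡ; reflexive; setoid)
  module ≈ = CommutativeMonoid M using (refl)
  open import Algebra.Properties.CommutativeMonoid.Sum M using (sum; ∑-distrib-+; sum-cong-≋)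
  open import Relation.Binary.Reasoning.Setoid setoid
  open IndicatorSums M

  leader : ℚ → Maybe (Fin n)
  leader q with FP.any? (λ z → pos z ℚ.≟ q)
  ... | yes (z , _) = just z
  ... | no _        = nothing

  leader-pos : ∀ {q z} → leader q ≡ just z → pos z ≡ q
  leader-pos {q} with FP.any? (λ z → pos z ℚ.≟ q)
  ... | yes (z , pz≡q) = λ { refl → pz≡q }
  ... | no _           = λ ()

  leader-exists : ∀ {z} → ∃[ w ] leader (pos z) ≡ just w
  leader-exists {z} with FP.any? (λ w → pos w ℚ.≟ pos z)
  ... | yes (w , _) = w , refl
  ... | no none     = ⊥-elim (none (z , refl))

  Counted : ℚ → Fin n → Set
  Counted q z = leader (pos z) ≡ just z × IsPositiveInteger (q - pos z)

  counted? : ∀ q z → Dec (Counted q z)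
  counted? q z = MaybeP.≡-dec FP._≟_ (leader (pos z)) (just z) ×-dec isPositiveInteger? (q - pos z)

  Counted-suc : ∀ q z → Counted (q + 1ℚ) z ⇔ (Counted q z ⊎ leader q ≡ just z)
  Counted-suc q z = mk⇔ forward backward
    where
    open +-*-Solver using (solve; _:+_; _:-_; _:=_; con)
    step : (q + 1ℚ) - pos z ≡ (q - pos z) + 1ℚ
    step = solve 2 (λ q p → (q :+ con 1ℚ) :- p := (q :- p) :+ con 1ℚ) refl q (pos z)
    forward : Counted (q + 1ℚ) z → Counted q z ⊎ leader q ≡ just z
    forward (lead , above) = conclude (to (IsPositiveInteger-suc (q - pos z)) (subst IsPositiveInteger step above))
      where
      conclude : q - pos z ≡ 0ℚ ⊎ IsPositiveInteger (q - pos z) → Counted q z ⊎ leader q ≡ just z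
      conclude (inj₁ q-p≡0) = inj₂ (trans (cong leader (p-q≡0⇒p≡q q-p≡0)) lead)
      conclude (inj₂ pi)    = inj₁ (lead , pi)
    backward : Counted q z ⊎ leader q ≡ just z → Counted (q + 1ℚ) z
    backward (inj₁ (lead , pi)) = lead , subst IsPositiveInteger (sym step) (from (IsPositiveInteger-suc _) (inj₂ pi))
    backward (inj₂ lead-q) = trans (cong leader (leader-pos lead-q)) lead-q
                           , subst IsPositiveInteger (sym step) (from (IsPositiveInteger-suc _) (inj₁ q-p≡0))
      where
      q-p≡0 : q - pos z ≡ 0ℚ
      q-p≡0 = trans (cong (λ p → q - p) (leader-pos lead-q)) (ℚP.+-inverseʳ q)

  Counted-disjoint : ∀ q z → ¬ (Counted q z × leader q ≡ just z)
  Counted-disjoint q z ((_ , pi) , lead-q) =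
    ¬IsPositiveInteger-0
      (subst IsPositiveInteger (trans (cong (λ p → q - p) (leader-pos lead-q)) (ℚP.+-inverseʳ q)) pi)

  potential : (ℚ → Carrier) → ℚ → Carrier
  potential σ q = sum λ z → when (counted? q z) (σ (pos z))

  potential-suc : ∀ σ z → potential σ (pos z + 1ℚ) ≈ potential σ (pos z) ∙ σ (pos z)
  potential-suc σ z = begin
    potential σ (q + 1ℚ)
      ≈⟨ sum-cong-≋ (λ w → when-⊎ (Counted-suc q w) (Counted-disjoint q w) (counted? (q + 1ℚ) w) (counted? q w)
                                   (is-leader? w) (σ (pos w))) ⟩
    sum (λ w → when (counted? q w) (σ (pos w)) ∙ when (is-leader? w) (σ (pos w)))
      ≈⟨ ∑-distrib-+ (λ w → when (counted? q w) (σ (pos w))) (λ w → when (is-leader? w) (σ (pos w))) ⟩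
    potential σ q ∙ sum (λ w → when (is-leader? w) (σ (pos w)))
      ≈⟨ ∙-congˡ (sum-single _ ℓz others) ⟩
    potential σ q ∙ when (is-leader? ℓz) (σ (pos ℓz))
      ≈⟨ ∙-congˡ (at-leader (is-leader? ℓz)) ⟩
    potential σ q ∙ σ q ∎
    where
    q = pos z
    is-leader? : ∀ w → Dec (leader q ≡ just w)
    is-leader? w = MaybeP.≡-dec FP._≟_ (leader q) (just w)
    ℓz = proj₁ (leader-exists {z})
    lead : leader q ≡ just ℓz
    lead = proj₂ (leader-exists {z})
    others : ∀ w → w ≢ ℓz → when (is-leader? w) (σ (pos w)) ≈ ε
    others w w≢ with is-leader? w
    ... | yes lead-w = ⊥-elim (w≢ (MaybeP.just-injective (trans (sym lead-w) lead)))
    ... | no _       = ≈.refl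
    at-leader : (d : Dec (leader q ≡ just ℓz)) → when d (σ (pos ℓz)) ≈ σ q
    at-leader (yes _)    = reflexive (cong σ (leader-pos lead))
    at-leader (no ¬lead) = ⊥-elim (¬lead lead)

-- Decision procedures and layouts

_≟ᵀ_ : DecidableEquality IType
A ≟ᵀ A = yes refl
A ≟ᵀ B = no λ ()
A ≟ᵀ C = no λ ()
A ≟ᵀ D = no λ ()
B ≟ᵀ A = no λ ()
B ≟ᵀ B = yes refl
B ≟ᵀ C = no λ ()
B ≟ᵀ D = no λ ()
C ≟ᵀ A = no λ ()
C ≟ᵀ B = no λ ()
C ≟ᵀ C = yes refl
C ≟ᵀ D = no λ ()
D ≟ᵀ A = no λ ()
D ≟ᵀ B = no λ ()
D ≟ᵀ C = no λ ()
D ≟ᵀ D = yes refl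

tie? : ∀ s t → Dec (Tie s t)
tie? s t = (T? (endOpen s) ⊎-dec T? (cenOpen t)) ×-dec (T? (endOpen t) ⊎-dec T? (cenOpen s))

precedesℤ? : ∀ a b s t → Dec (Precedes ℤ._<_ a b s t)
precedesℤ? a b s t = (a ℤ.<? b) ⊎-dec ((a ℤ.≟ b) ×-dec tie? s t)

_⇔?_ : {X Y : Set} → Dec X → Dec Y → Dec (X ⇔ Y)
x? ⇔? y? = map′ (λ (f , g) → mk⇔ f g) (λ e → to e , from e) ((x? →-dec y?) ×-dec (y? →-dec x?))

∀-in? : {X : Set} {Q : X → Set} (xs : List X) → (∀ x → x ∈ xs) → (∀ x → Dec (Q x)) → Dec (∀ x → Q x)
∀-in? xs complete Q? =
  map′ (λ all x → All.lookup all (complete x)) (λ h → All.tabulate (λ {x} _ → h x)) (All.all? Q? xs)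

every-bool : ∀ b → b ∈ true ∷ false ∷ []
every-bool true  = here refl
every-bool false = there (here refl)

every-type : ∀ t → t ∈ A ∷ B ∷ C ∷ D ∷ []
every-type A = here refl
every-type B = there (here refl)
every-type C = there (there (here refl))
every-type D = there (there (there (here refl)))

∀-Bool? : {Q : Bool → Set} → (∀ b → Dec (Q b)) → Dec (∀ b → Q b)
∀-Bool? = ∀-in? _ every-bool

∀-IType? : {Q : IType → Set} → (∀ t → Dec (Q t)) → Dec (∀ t → Q t)
∀-IType? = ∀-in? _ every-type

-- A layout places the elements of a pattern on four consecutive unit-spaced levels, with types.
Layout : ℕ → Set
Layout k = Fin k → Fin 4 × IType

Realises : (Q : Pattern) → Layout (Pattern.k Q) → Set
Realises Q ℓ =
  (∀ i j → Pattern.rel Q i j ⇔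
           Precedes ℤ._<_ (+ toℕ (proj₁ (ℓ i)) ℤ.+ + 1) (+ toℕ (proj₁ (ℓ j))) (proj₂ (ℓ i)) (proj₂ (ℓ j)))
  × (∀ i j → ℓ i ≡ ℓ j → i ≡ j)

realises? : (Q : Pattern) → (∀ i j → Dec (Pattern.rel Q i j)) → (ℓ : Layout (Pattern.k Q)) → Dec (Realises Q ℓ)
realises? Q rel? ℓ =
  FP.all? (λ i → FP.all? (λ j → rel? i j ⇔? precedesℤ? _ _ (proj₂ (ℓ i)) (proj₂ (ℓ j))))
  ×-dec FP.all? (λ i → FP.all? (λ j → ×P.≡-dec FP._≟_ _≟ᵀ_ (ℓ i) (ℓ j) →-dec i FP.≟ j))

TieFerrers : List IType → Set
TieFerrers S = ∀ a b c d → a ∈ S → b ∈ S → c ∈ S → d ∈ S → Tie a b → Tie c d → Tie a d ⊎ Tie c b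

tieFerrers? : ∀ S → Dec (TieFerrers S)
tieFerrers? S = ∀-IType? λ a → ∀-IType? λ b → ∀-IType? λ c → ∀-IType? λ d →
  (a ∈? S) →-dec (b ∈? S) →-dec (c ∈? S) →-dec (d ∈? S) →-dec
  tie? a b →-dec tie? c d →-dec (tie? a d ⊎-dec tie? c b)
  where open import Data.List.Membership.DecPropositional _≟ᵀ_ using (_∈?_)

module Levels {S : List IType} {P : FinPoset} (N : UnitRep S P) where
  open FinPoset P using (n; _≺_)
  open UnitRep N

  Slot : ℚ → IType → Set
  Slot q t = ∃[ z ] L z ≡ q × ty z ≡ t

  slot? : ∀ q t → Dec (Slot q t)
  slot? q t = FP.any? (λ z → (L z ℚ.≟ q) ×-dec (ty z ≟ᵀ t))

  layout-embeds : (Q : Pattern) (ℓ : Layout (Pattern.k Q)) → Realises Q ℓ → (b : ℚ) →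
                  (∀ i → Slot (b + fromℤ (+ toℕ (proj₁ (ℓ i)))) (proj₂ (ℓ i))) → ContainsInduced Q P
  layout-embeds Q ℓ (rel⇔ , distinct) b slot = f , injective , λ i j → to (related i j) , from (related i j)
    where
    f : Fin (Pattern.k Q) → Fin n
    f i = proj₁ (slot i)
    height : Fin (Pattern.k Q) → ℤ
    height i = + toℕ (proj₁ (ℓ i))
    at : ∀ i → L (f i) ≡ b + fromℤ (height i)
    at i = proj₁ (proj₂ (slot i))
    typed : ∀ i → ty (f i) ≡ proj₂ (ℓ i)
    typed i = proj₂ (proj₂ (slot i))
    injective : ∀ {i j} → f i ≡ f j → i ≡ j
    injective {i} {j} fi≡fj =
      distinct i j (cong₂ _,_ (FP.toℕ-injective (ℤP.+-injective (cong ℚ.numerator same-height)))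
                              (trans (sym (typed i)) (trans (cong ty fi≡fj) (typed j))))
      where
      same-height : fromℤ (height i) ≡ fromℤ (height j)
      same-height = +-cancelˡ b (trans (sym (at i)) (trans (cong L fi≡fj) (at j)))
    lift : ℤ → ℚ
    lift k = b + fromℤ k
    related : ∀ i j → Pattern.rel Q i j ⇔ f i ≺ f j
    related i j =
      ⇔-trans (rel⇔ i j)
      (⇔-trans (Precedes-map ℤP.<-cmp ℚP.<-irrefl ℚP.<-asym lift (ℚP.+-monoʳ-< b ∘ fromℤ-mono-<))
      (⇔-trans (Precedes-cong {_<_ = _<_} above (sym (at j)) (sym (typed i)) (sym (typed j)))
               (⇔-sym (correct (f i) (f j)))))
      where
      above : lift (height i ℤ.+ + 1) ≡ L (f i) + 1ℚ
      above = trans (cong (λ q → b + q) (fromℤ-+ (height i) (+ 1)))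
                    (trans (sym (ℚP.+-assoc b (fromℤ (height i)) 1ℚ)) (cong (_+ 1ℚ) (sym (at i))))

  unit-pair : ∀ {x y} → L y ≡ L x + 1ℚ → x ≺ y ⇔ Tie (ty x) (ty y)
  unit-pair {x} {y} unit =
    ⇔-trans (correct x y) (⇔-trans (Precedes-cong {_<_ = _<_} refl unit refl refl) (Precedes-refl ℚP.<-irrefl))

  no-2+2 : TieFerrers S → ¬ ContainsInduced TwoPlusTwo P
  no-2+2 ferrers (f , _ , rel) =
    [ ¬a≺d ∘ from (unit-pair ad-unit) , ¬c≺b ∘ from (unit-pair cb-unit) ]′
      (ferrers _ _ _ _ (ty∈S a) (ty∈S b) (ty∈S c) (ty∈S d) (to (unit-pair ab-unit) a≺b) (to (unit-pair cd-unit) c≺d))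
    where
    a b c d : Fin n
    a = f 0F
    b = f 1F
    c = f 2F
    d = f 3F
    a≺b : a ≺ b
    a≺b = proj₁ (rel 0F 1F) _
    c≺d : c ≺ d
    c≺d = proj₁ (rel 2F 3F) _
    ¬a≺d : ¬ a ≺ d
    ¬a≺d = proj₂ (rel 0F 3F)
    ¬c≺b : ¬ c ≺ b
    ¬c≺b = proj₂ (rel 2F 1F)
    ab : L a + 1ℚ ≤ L b
    ab = Precedes⇒≤ (to (correct a b) a≺b)
    cd : L c + 1ℚ ≤ L d
    cd = Precedes⇒≤ (to (correct c d) c≺d)
    da : L d ≤ L a + 1ℚ
    da = ¬Precedes⇒≥ (¬a≺d ∘ from (correct a d))
    bc : L b ≤ L c + 1ℚ
    bc = ¬Precedes⇒≥ (¬c≺b ∘ from (correct c b))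
    -- ab, bc, cd and da close the cycle L a + 1 ≤ L b ≤ L c + 1 ≤ L d ≤ L a + 1.
    ab-unit : L b ≡ L a + 1ℚ
    ab-unit = ℚP.≤-antisym (ℚP.≤-trans bc (ℚP.≤-trans cd da)) ab
    cd-unit : L d ≡ L c + 1ℚ
    cd-unit = ℚP.≤-antisym (ℚP.≤-trans da (ℚP.≤-trans ab bc)) cd
    ad-unit : L d ≡ L a + 1ℚ
    ad-unit = ℚP.≤-antisym da (ℚP.≤-trans ab (ℚP.≤-trans bc cd))
    cb-unit : L b ≡ L c + 1ℚ
    cb-unit = ℚP.≤-antisym bc (ℚP.≤-trans cd (ℚP.≤-trans da ab))

-- Local retyping rules

Window : Set
Window = Bool × Bool

∀-Window? : {Q : Window → Set} → (∀ w → Dec (Q w)) → Dec (∀ w → Q w)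
∀-Window? = ∀-in? _ λ (b₁ , b₂) → ∈-cartesianProduct⁺ (every-bool b₁) (every-bool b₂)

module TwoTypes (T₁ T₂ : IType) where

  -- A window records which of the two types occur on a level.
  Occupies : Window → IType → Set
  Occupies (b₁ , b₂) s = (s ≡ T₁ × T b₁) ⊎ (s ≡ T₂ × T b₂)

  occupies? : ∀ w s → Dec (Occupies w s)
  occupies? (b₁ , b₂) s = ((s ≟ᵀ T₁) ×-dec T? b₁) ⊎-dec ((s ≟ᵀ T₂) ×-dec T? b₂)

  Across : (IType → IType → Set) → Window → Window → Set
  Across R w₀ w₁ = ∀ s t → Occupies w₀ s → Occupies w₁ t → R s t

  across? : {R : IType → IType → Set} → (∀ s t → Dec (R s t)) → ∀ w₀ w₁ → Dec (Across R w₀ w₁)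
  across? R? w₀ w₁ = ∀-IType? λ s → ∀-IType? λ t → occupies? w₀ s →-dec occupies? w₁ t →-dec R? s t

  step : Window → Window → ℤ
  step w₀ w₁ with across? tie? w₀ w₁ | across? (λ s t → ¬? (tie? s t)) w₀ w₁
  ... | yes _ | _     = + 1
  ... | no _  | yes _ = ℤ.-1ℤ
  ... | no _  | no _  = + 0

  record LocalRule : Set₁ where
    field
      offset  : Bool → Window → Window → Window → IType → ℤ
      retype  : Bool → Window → Window → Window → IType → IType
      avoided : Pattern
      layouts : List (Layout (Pattern.k avoided))

    OccursIn : Layout (Pattern.k avoided) → Vec Window 4 → Set
    OccursIn ℓ ws = ∀ i → Occupies (lookup ws (proj₁ (ℓ i))) (proj₂ (ℓ i))

    Forbidden : Vec Window 4 → Set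
    Forbidden ws = Any (λ ℓ → OccursIn ℓ ws) layouts

    forbidden? : ∀ ws → Dec (Forbidden ws)
    forbidden? ws =
      Any.any? (λ ℓ → FP.all? (λ i → occupies? (lookup ws (proj₁ (ℓ i))) (proj₂ (ℓ i)))) layouts

    -- x on a level q of parity p and y on q + 1; the windows are those of the levels q - 1, …, q + 2.
    Resolves : Bool → Window → Window → Window → Window → IType → IType → Set
    Resolves p w₋ w₀ w₁ w₂ s t =
      Tie s t ⇔ Precedes ℤ._<_ (offset p w₋ w₀ w₁ s) (+ 3 ℤ.* step w₀ w₁ ℤ.+ offset (not p) w₀ w₁ w₂ t)
                               (retype p w₋ w₀ w₁ s) (retype (not p) w₀ w₁ w₂ t)

    record Sound (S′ : List IType) : Set where
      field
        realises : All (Realises avoided) layouts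
        retype∈  : ∀ p w₋ w₀ w₁ s → Occupies w₀ s → retype p w₋ w₀ w₁ s ∈ S′
        resolves : ∀ p w₋ w₀ w₁ w₂ s t → Occupies w₀ s → Occupies w₁ t →
                   ¬ Forbidden (w₋ ∷ w₀ ∷ w₁ ∷ w₂ ∷ []) → Resolves p w₋ w₀ w₁ w₂ s t

    sound? : (∀ i j → Dec (Pattern.rel avoided i j)) → ∀ S′ → Dec (Sound S′)
    sound? rel? S′ =
      map′ (λ (r , t , s) → record { realises = r ; retype∈ = t ; resolves = s })
           (λ s → Sound.realises s , Sound.retype∈ s , Sound.resolves s)
           (All.all? (realises? avoided rel?) layouts
            ×-dec (∀-Bool? λ p → ∀-Window? λ w₋ → ∀-Window? λ w₀ → ∀-Window? λ w₁ → ∀-IType? λ s →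
                     occupies? w₀ s →-dec (retype p w₋ w₀ w₁ s ∈? S′))
            ×-dec (∀-Bool? λ p → ∀-Window? λ w₋ → ∀-Window? λ w₀ → ∀-Window? λ w₁ → ∀-Window? λ w₂ →
                   ∀-IType? λ s → ∀-IType? λ t →
                     occupies? w₀ s →-dec occupies? w₁ t →-dec ¬? (forbidden? (w₋ ∷ w₀ ∷ w₁ ∷ w₂ ∷ [])) →-dec
                     (tie? s t ⇔? precedesℤ? _ _ _ _)))
      where open import Data.List.Membership.DecPropositional _≟ᵀ_ using (_∈?_)

  -- The offsets lie in {-1, 0, 1}; the factor 3 lets a nonzero height step outweigh them.
  module Apply (rule : LocalRule) {S′ : List IType} (sound : LocalRule.Sound rule S′) {P : FinPoset}
               (N : UnitRep (T₁ ∷ T₂ ∷ []) P) (avoid : ¬ ContainsInduced (LocalRule.avoided rule) P) where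
    open FinPoset P using (n; _≺_)
    open LocalRule rule
    open Sound sound
    open UnitRep N
    open Levels N
    open +-*-Solver using (solve; _:+_; _:-_; _:=_; con)

    W : ℚ → Window
    W q = isYes (slot? q T₁) , isYes (slot? q T₂)

    around : Fin n → ℕ → Window
    around x i = W (L x - 1ℚ + fromℤ (+ i))

    module Height = Potential L ℤP.+-0-commutativeMonoid
    module Parity = Potential L (CommutativeRing.+-commutativeMonoid BoolP.xor-∧-commutativeRing)

    level-step : ℚ → ℤ
    level-step q = step (W q) (W (q + 1ℚ))

    height : ℚ → ℤ
    height = Height.potential level-step

    parity : ℚ → Bool
    parity = Parity.potential (λ _ → true)

    g : Fin n → ℤ
    g x = + 3 ℤ.* height (L x) ℤ.+ offset (parity (L x)) (around x 0) (around x 1) (around x 2) (ty x)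

    ty′ : Fin n → IType
    ty′ x = retype (parity (L x)) (around x 0) (around x 1) (around x 2) (ty x)

    occupies-W : ∀ {q z} → L z ≡ q → Occupies (W q) (ty z)
    occupies-W {q} {z} at with ty∈S z
    ... | here is-T₁         = inj₁ (is-T₁ , fromWitness {a? = slot? q T₁} (z , at , is-T₁))
    ... | there (here is-T₂) = inj₂ (is-T₂ , fromWitness {a? = slot? q T₂} (z , at , is-T₂))

    W-slot : ∀ {q s} → Occupies (W q) s → Slot q s
    W-slot {q} (inj₁ (refl , occupied)) = toWitness {a? = slot? q T₁} occupied
    W-slot {q} (inj₂ (refl , occupied)) = toWitness {a? = slot? q T₂} occupied

    around-1 : ∀ x → around x 1 ≡ W (L x)
    around-1 x = cong W (solve 1 (λ a → (a :- con 1ℚ) :+ con 1ℚ := a) refl (L x))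

    around-2 : ∀ x → around x 2 ≡ W (L x + 1ℚ)
    around-2 x = cong W (solve 1 (λ a → (a :- con 1ℚ) :+ (con 1ℚ :+ con 1ℚ) := a :+ con 1ℚ) refl (L x))

    around-suc : ∀ {x y} → L y ≡ L x + 1ℚ → ∀ i → around y i ≡ around x (ℕ.suc i)
    around-suc {x} unit i = cong W (begin
      L _ - 1ℚ + fromℤ (+ i)               ≡⟨ cong (λ q → q - 1ℚ + fromℤ (+ i)) unit ⟩
      L x + 1ℚ - 1ℚ + fromℤ (+ i)
        ≡⟨ solve 2 (λ a f → a :+ con 1ℚ :- con 1ℚ :+ f := a :- con 1ℚ :+ (f :+ con 1ℚ)) refl (L x) (fromℤ (+ i)) ⟩
      L x - 1ℚ + (fromℤ (+ i) + 1ℚ)        ≡⟨ cong (λ f → L x - 1ℚ + f) (sym (fromℤ-suc i)) ⟩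
      L x - 1ℚ + fromℤ (+ ℕ.suc i)         ∎)
      where open ≡-Reasoning

    not-forbidden : ∀ x → ¬ Forbidden (around x 0 ∷ around x 1 ∷ around x 2 ∷ around x 3 ∷ [])
    not-forbidden x forbidden = avoid (layout-embeds avoided ℓ realised (L x - 1ℚ) slot)
      where
      ℓ : Layout (Pattern.k avoided)
      ℓ = Any.lookup forbidden
      realised : Realises avoided ℓ
      realised = proj₁ (All.lookupAny realises forbidden)
      slot : ∀ i → Slot (L x - 1ℚ + fromℤ (+ toℕ (proj₁ (ℓ i)))) (proj₂ (ℓ i))
      slot i = W-slot (subst (λ w → Occupies w (proj₂ (ℓ i))) (VecP.lookup∘tabulate (around x ∘ toℕ) (proj₁ (ℓ i)))
                             (proj₂ (All.lookupAny realises forbidden) i))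

    own : ∀ x → Occupies (around x 1) (ty x)
    own x = subst (λ w → Occupies w (ty x)) (sym (around-1 x)) (occupies-W refl)

    next : ∀ {x y} → L y ≡ L x + 1ℚ → Occupies (around x 2) (ty y)
    next {x} unit = subst (λ w → Occupies w _) (sym (around-2 x)) (occupies-W unit)

    parity-suc : ∀ {x y} → L y ≡ L x + 1ℚ → parity (L y) ≡ not (parity (L x))
    parity-suc {x} {y} unit = begin
      parity (L y)          ≡⟨ cong parity unit ⟩
      parity (L x + 1ℚ)     ≡⟨ Parity.potential-suc (λ _ → true) x ⟩
      parity (L x) xor true ≡⟨ BoolP.xor-comm (parity (L x)) true ⟩
      true xor parity (L x) ≡⟨ BoolP.true-xor (parity (L x)) ⟩
      not (parity (L x))    ∎
      where open ≡-Reasoning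

    height-suc : ∀ {x y} → L y ≡ L x + 1ℚ → height (L y) ≡ height (L x) ℤ.+ step (around x 1) (around x 2)
    height-suc {x} unit =
      trans (cong height unit)
            (trans (Height.potential-suc level-step x)
                   (cong₂ (λ w₀ w₁ → height (L x) ℤ.+ step w₀ w₁) (sym (around-1 x)) (sym (around-2 x))))

    shifted-context : ∀ {x y} → L y ≡ L x + 1ℚ → {R : Set} (f : Bool → Window → Window → Window → R) →
                      f (parity (L y)) (around y 0) (around y 1) (around y 2)
                      ≡ f (not (parity (L x))) (around x 1) (around x 2) (around x 3)
    shifted-context unit f =
      cong₂ (λ p (w₋ , w₀ , w₁) → f p w₋ w₀ w₁) (parity-suc unit)
            (cong₂ _,_ (around-suc unit 0) (cong₂ _,_ (around-suc unit 1) (around-suc unit 2)))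

    g-suc : ∀ {x y} → L y ≡ L x + 1ℚ →
            g y ≡ + 3 ℤ.* height (L x) ℤ.+ (+ 3 ℤ.* step (around x 1) (around x 2)
                                            ℤ.+ offset (not (parity (L x))) (around x 1) (around x 2) (around x 3) (ty y))
    g-suc {x} {y} unit = begin
      g y
        ≡⟨ cong₂ (λ h o → + 3 ℤ.* h ℤ.+ o) (height-suc unit)
                 (shifted-context unit (λ p w₋ w₀ w₁ → offset p w₋ w₀ w₁ (ty y))) ⟩
      + 3 ℤ.* (height (L x) ℤ.+ s) ℤ.+ o
        ≡⟨ cong (ℤ._+ o) (ℤP.*-distribˡ-+ (+ 3) (height (L x)) s) ⟩
      + 3 ℤ.* height (L x) ℤ.+ + 3 ℤ.* s ℤ.+ o
        ≡⟨ ℤP.+-assoc (+ 3 ℤ.* height (L x)) (+ 3 ℤ.* s) o ⟩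
      + 3 ℤ.* height (L x) ℤ.+ (+ 3 ℤ.* s ℤ.+ o) ∎
      where
      open ≡-Reasoning
      s = step (around x 1) (around x 2)
      o = offset (not (parity (L x))) (around x 1) (around x 2) (around x 3) (ty y)

    ties : ∀ x y → L y ≡ L x + 1ℚ → x ≺ y ⇔ Precedes ℤ._<_ (g x) (g y) (ty′ x) (ty′ y)
    ties x y unit =
      ⇔-trans (unit-pair unit)
      (⇔-trans (resolves (parity (L x)) (around x 0) (around x 1) (around x 2) (around x 3) (ty x) (ty y)
                         (own x) (next unit) (not-forbidden x))
      (⇔-trans (Precedes-map ℤP.<-cmp ℤP.<-irrefl ℤP.<-asym (λ k → + 3 ℤ.* height (L x) ℤ.+ k)
                             (ℤP.+-monoʳ-< (+ 3 ℤ.* height (L x))))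
               (Precedes-cong {_<_ = ℤ._<_} refl (sym (g-suc unit)) refl
                              (sym (shifted-context unit (λ p w₋ w₀ w₁ → retype p w₋ w₀ w₁ (ty y)))))))

    retyped : UnitRep S′ P
    retyped = perturb N ty′ (λ x → retype∈ (parity (L x)) (around x 0) (around x 1) (around x 2) (ty x) (own x))
                      g ties

-- The four retypings

_==ᵀ_ : IType → IType → Bool
s ==ᵀ t = isYes (s ≟ᵀ t)

mixed : Window → Bool
mixed (b₁ , b₂) = b₁ ∧ b₂

nonempty : Window → Bool
nonempty (b₁ , b₂) = b₁ ∨ b₂

indicator : Bool → ℤ
indicator true  = + 1
indicator false = + 0

module FromCD = TwoTypes C D
module FromAC = TwoTypes A C
module FromAB = TwoTypes A B

twoPlusTwo-at : Fin 3 → Layout 4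
twoPlusTwo-at i = lookup ((inject₁ i , C) ∷ (suc i , C) ∷ (inject₁ i , D) ∷ (suc i , D) ∷ [])

-- Without 2+2 no two consecutive levels are mixed, so a mixed level has pure neighbours: its elements
-- of the neighbours' type must tie with them and the others must not. When the two neighbours have
-- different types, an offset of ±1 decides instead of the tie.
fromCD : (tying untying neutral : IType) → FromCD.LocalRule
fromCD tying untying neutral = record
  { offset  = λ _ prev own next t →
      if mixed own ∧ split prev next then (if t ==ᵀ sole prev then + 1 else ℤ.-1ℤ) else + 0
  ; retype  = λ _ prev own next t →
      if mixed own ∧ not (split prev next) then (if t ==ᵀ neighbour prev next then tying else untying) else neutral
  ; avoided = TwoPlusTwo
  ; layouts = twoPlusTwo-at 0F ∷ twoPlusTwo-at 1F ∷ twoPlusTwo-at 2F ∷ []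
  }
  where
  sole : Window → IType
  sole (false , true) = D
  sole _              = C
  split : Window → Window → Bool
  split prev next = nonempty prev ∧ nonempty next ∧ not (sole prev ==ᵀ sole next)
  neighbour : Window → Window → IType
  neighbour prev next = if nonempty prev then sole prev else sole next

cd→ab : FromCD.LocalRule
cd→ab = fromCD B A A

cd→ab-sound : FromCD.LocalRule.Sound cd→ab AB
cd→ab-sound = from-yes (FromCD.LocalRule.sound? cd→ab (λ i j → T? _) AB)

cd→ac : FromCD.LocalRule
cd→ac = fromCD C A C

cd→ac-sound : FromCD.LocalRule.Sound cd→ac AC
cd→ac-sound = from-yes (FromCD.LocalRule.sound? cd→ac (λ i j → T? _) AC)

-- A becomes D and C stays C. Two A's on consecutive mixed levels would now tie; an offset separates
-- them unless both outer neighbouring levels contain a C, which is where Z appears.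
ac→cd : FromAC.LocalRule
ac→cd = record
  { offset  = λ _ prev own next t →
      if t ==ᵀ C then + 0
      else indicator (mixed own ∧ mixed next ∧ not (proj₂ prev))
           ℤ.- indicator (mixed own ∧ mixed prev ∧ not (proj₂ next))
  ; retype  = λ _ _ _ _ t → if t ==ᵀ C then C else D
  ; avoided = Z
  ; layouts = lookup ((0F , C) ∷ (1F , C) ∷ (2F , C) ∷ (3F , C) ∷ (1F , A) ∷ (2F , A) ∷ []) ∷ []
  }

ac→cd-sound : FromAC.LocalRule.Sound ac→cd CD
ac→cd-sound = from-yes (FromAC.LocalRule.sound? ac→cd (λ i j → T? _) CD)

-- A's alternate between C and D from level to level and a B takes the type of the A's on the adjacent
-- levels. Two B's on consecutive mixed levels would now not tie; an offset makes them comparable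
-- unless both outer neighbouring levels contain an A, which is where H appears.
ab→cd : FromAB.LocalRule
ab→cd = record
  { offset  = λ _ prev _ next t →
      if t ==ᵀ A then + 0
      else indicator (mixed prev ∧ not (proj₁ next)) ℤ.- indicator (mixed next ∧ not (proj₁ prev))
  ; retype  = λ p _ _ _ t → if t ==ᵀ A then alternate p else alternate (not p)
  ; avoided = H
  ; layouts = lookup ((0F , A) ∷ (1F , B) ∷ (2F , B) ∷ (3F , A) ∷ (1F , A) ∷ (2F , A) ∷ []) ∷ []
  }
  where
  alternate : Bool → IType
  alternate p = if p then C else D

ab→cd-sound : FromAB.LocalRule.Sound ab→cd CD
ab→cd-sound = from-yes (FromAB.LocalRule.sound? ab→cd (λ i j → T? _) CD)

module _ {P : FinPoset} where

  cd⇒ab : UnitRep CD P → ¬ ContainsInduced TwoPlusTwo P → UnitRep AB P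
  cd⇒ab = FromCD.Apply.retyped cd→ab cd→ab-sound

  cd⇒ac : UnitRep CD P → ¬ ContainsInduced TwoPlusTwo P → UnitRep AC P
  cd⇒ac = FromCD.Apply.retyped cd→ac cd→ac-sound

  ac⇒cd : UnitRep AC P → ¬ ContainsInduced Z P → UnitRep CD P
  ac⇒cd = FromAC.Apply.retyped ac→cd ac→cd-sound

  ab⇒cd : UnitRep AB P → ¬ ContainsInduced H P → UnitRep CD P
  ab⇒cd = FromAB.Apply.retyped ab→cd ab→cd-sound

  ac-no-2+2 : UnitRep AC P → ¬ ContainsInduced TwoPlusTwo P
  ac-no-2+2 N = Levels.no-2+2 N (from-yes (tieFerrers? AC))

  ab-no-2+2 : UnitRep AB P → ¬ ContainsInduced TwoPlusTwo P
  ab-no-2+2 N = Levels.no-2+2 N (from-yes (tieFerrers? AB))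

proposition14 : (P : FinPoset) →
    (IsSOrder CD P → ¬ ContainsInduced TwoPlusTwo P → IsSOrder AB P × IsSOrder AC P)
    × (IsSOrder AC P → ¬ ContainsInduced Z P → IsSOrder AB P × IsSOrder CD P)
    × (IsSOrder AB P → ¬ ContainsInduced H P → IsSOrder CD P × IsSOrder AC P)
proposition14 P = from-CD , from-AC , from-AB
  where
  from-CD : IsSOrder CD P → ¬ ContainsInduced TwoPlusTwo P → IsSOrder AB P × IsSOrder AC P
  from-CD rep no-2+2 = representation (cd⇒ab (unitRep rep) no-2+2) , representation (cd⇒ac (unitRep rep) no-2+2)

  from-AC : IsSOrder AC P → ¬ ContainsInduced Z P → IsSOrder AB P × IsSOrder CD P
  from-AC rep no-Z = representation (cd⇒ab N (ac-no-2+2 (unitRep rep))) , representation N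
    where
    N : UnitRep CD P
    N = ac⇒cd (unitRep rep) no-Z

  from-AB : IsSOrder AB P → ¬ ContainsInduced H P → IsSOrder CD P × IsSOrder AC P
  from-AB rep no-H = representation N , representation (cd⇒ac N (ab-no-2+2 (unitRep rep)))
    where
    N : UnitRep CD P
    N = ab⇒cd (unitRep rep) no-H
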